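{- Let $k\ge 1$, $a\ge 1$, $b\ge 0$ and $c\ge 1$ be integers, and let $f$ be a multiplicative function with $f(n)\neq 0$ for all positive integers $n$. Define $g_{k,f}$ on positive integers $n$ by $$g_{k,f}(n):=\frac{\prod_{i=0}^k f(b+a(n+ic))}{f\big(\mathrm{lcm}_{0\le i\le k}\{b+a(n+ic)\}\big)}.$$ Then $g_{k,f}$ is periodic and $cL_k$ is a period of it, i.e. $g_{k,f}(n+cL_k)=g_{k,f}(n)$ for all positive integers $n$.
   Context: $L_k:=\mathrm{lcm}(1,2,\ldots,k)$ for $k\ge1$. -}

module Defs where

open import Level using (Level)
open import Data.Nat using (ℕ; zero; suc; _+_; _*_; _≥_)
open import Data.Nat.LCM using (lcm)
open import Data.Nat.Coprimality using (Coprime)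
open import Algebra.Bundles using (AbelianGroup)

L : ℕ → ℕ
L zero    = 1
L (suc k) = lcm (L k) (suc k)

term : ℕ → ℕ → ℕ → ℕ → ℕ → ℕ
term a b c n i = b + a * (n + i * c)

lcmTerms : ℕ → ℕ → ℕ → ℕ → ℕ → ℕ
lcmTerms zero    a b c n = term a b c n 0
lcmTerms (suc k) a b c n = lcm (lcmTerms k a b c n) (term a b c n (suc k))

module _ {ℓ₁ ℓ₂ : Level} (G : AbelianGroup ℓ₁ ℓ₂) where
  open AbelianGroup G

  Multiplicative : (ℕ → Carrier) → Set _
  Multiplicative f = ∀ m n → m ≥ 1 → n ≥ 1 → Coprime m n → f (m * n) ≈ f m ∙ f n

  prodTerms : (ℕ → Carrier) → ℕ → ℕ → ℕ → ℕ → ℕ → Carrier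
  prodTerms f zero    a b c n = f (term a b c n 0)
  prodTerms f (suc k) a b c n = prodTerms f k a b c n ∙ f (term a b c n (suc k))

  g : (ℕ → Carrier) → ℕ → ℕ → ℕ → ℕ → ℕ → Carrier
  g f k a b c n = prodTerms f k a b c n ∙ (f (lcmTerms k a b c n)) ⁻¹

module Submission where

-- For a multiplicative f and m, n ≥ 1 we have f(m) f(n) = f(gcd m n) f(lcm m n).
-- Applying this to lcm_{i<j} x_i and x_j for j = 1, …, k telescopes the quotient into
--     g_{k,f}(n) = ∏_{1≤j≤k} f(gcd(lcm_{i<j} x_i, x_j)),
-- and since gcd distributes over lcm,  gcd(lcm_{i<j} x_i, x_j) = lcm_{i<j} gcd(x_i, x_j).
-- Hence g_{k,f}(n) depends only on the pairwise gcds gcd(x_i, x_j), i < j ≤ k.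
-- Replacing n by n + c L_k adds L_k a c to every x_i, and x_j - x_i = (j - i) a c divides
-- L_k a c because 1 ≤ j - i ≤ k; so no pairwise gcd changes and g_{k,f} is periodic.

open import Defs
open import Level using (Level)
open import Data.Nat using (ℕ; zero; suc; _+_; _*_; _∸_; _≤_; _<_; _≥_; z≤n; s≤s; NonZero; >-nonZero; n>1⇒nonTrivial)
open import Data.Nat.Properties
open import Data.Nat.Divisibility
open import Data.Nat.GCD
open import Data.Nat.LCM
open import Data.Nat.DivMod using (_/_; m*[n/m]≡n)
open import Data.Nat.Coprimality using (Coprime; gcd≡1⇒coprime; coprime-divisor; coprime-/gcd) renaming (sym to coprime-sym)
open import Data.Nat.Induction using (<-wellFounded)
open import Data.Nat.Tactic.RingSolver using (solve-∀)
open import Induction.WellFounded using (Acc; acc)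
open import Data.Product using (Σ; _×_; _,_)
open import Data.Sum using (inj₁; inj₂)
open import Relation.Binary.PropositionalEquality using (_≡_; refl; sym; trans; cong; cong₂; subst; ≢-sym; module ≡-Reasoning)
open import Relation.Nullary using (yes; no; contradiction)
open import Algebra.Bundles using (AbelianGroup)
import Algebra.Properties.CommutativeSemigroup as CommSemigroupProperties
import Relation.Binary.Reasoning.Setoid as SetoidReasoning

∣-pos : ∀ {m n} → m ∣ n → n ≥ 1 → m ≥ 1
∣-pos {zero}  0∣n n≥1 = contradiction (0∣⇒≡0 0∣n) (n>0⇒n≢0 n≥1)
∣-pos {suc _} _   _   = s≤s z≤n

gcd-pos : ∀ m {n} → n ≥ 1 → gcd m n ≥ 1
gcd-pos m {n} = ∣-pos (gcd[m,n]∣n m n)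

lcm-pos : ∀ {m n} → m ≥ 1 → n ≥ 1 → lcm m n ≥ 1
lcm-pos {m} {n} m≥1 n≥1 = ∣-pos (lcm-least {m} {n} (m∣m*n n) (n∣m*n m)) (*-mono-≤ m≥1 n≥1)

coprime-∣ʳ : ∀ {m n e} → Coprime m n → e ∣ n → Coprime m e
coprime-∣ʳ m⊥n e∣n (d∣m , d∣e) = m⊥n (d∣m , ∣-trans d∣e e∣n)

coprime-*ʳ : ∀ {w m n} → Coprime w m → Coprime w n → Coprime w (m * n)
coprime-*ʳ w⊥m w⊥n (d∣w , d∣mn) =
  w⊥n (d∣w , coprime-divisor (λ { (e∣d , e∣m) → w⊥m (∣-trans e∣d d∣w , e∣m) }) d∣mn)

coprime-1 : ∀ w → Coprime w 1
coprime-1 w (_ , d∣1) = ∣1⇒≡1 d∣1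

-- v is supported by x: every prime factor of v divides x, phrased without primes as
-- "whatever is coprime to x is coprime to v".
SupportedBy : ℕ → ℕ → Set
SupportedBy x v = ∀ {w} → Coprime w x → Coprime w v

-- Every d ≥ 1 splits as d = u v with u coprime to x and v supported by x.
-- Repeatedly divide out e = gcd(d, x) > 1; the factors removed form v.
coprimeSplit : ∀ x d → d ≥ 1 → Σ ℕ λ u → Σ ℕ λ v → u * v ≡ d × Coprime u x × SupportedBy x v
coprimeSplit x d = split d (<-wellFounded d)
  where
  split : ∀ d → Acc _<_ d → d ≥ 1 → Σ ℕ λ u → Σ ℕ λ v → u * v ≡ d × Coprime u x × SupportedBy x v
  split d (acc rec) d≥1 with gcd d x ≟ 1
  ... | yes e≡1 = d , 1 , *-identityʳ d , gcd≡1⇒coprime e≡1 , λ {w} _ → coprime-1 w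
  ... | no  e≢1 with split q (rec q<d) (∣-pos (quotient-∣ e∣d) d≥1)
    where
    e = gcd d x
    e∣d = gcd[m,n]∣m d x
    q = quotient e∣d
    q<d : q < d
    q<d = quotient-< e∣d {{n>1⇒nonTrivial (≤∧≢⇒< (∣-pos e∣d d≥1) (≢-sym e≢1))}} {{>-nonZero d≥1}}
  ... | u , v , uv≡q , u⊥x , v-supp = u , gcd d x * v , u[ev]≡d , u⊥x , ev-supp
    where
    u[ev]≡d : u * (gcd d x * v) ≡ d
    u[ev]≡d = begin
      u * (gcd d x * v)  ≡⟨ x*[y*z]≡y*[x*z] u (gcd d x) v ⟩
      gcd d x * (u * v)  ≡⟨ cong (gcd d x *_) uv≡q ⟩
      gcd d x * quotient (gcd[m,n]∣m d x) ≡⟨ m∣n⇒n≡m*quotient (gcd[m,n]∣m d x) ⟨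
      d                  ∎
      where
      open ≡-Reasoning
      x*[y*z]≡y*[x*z] : ∀ x y z → x * (y * z) ≡ y * (x * z)
      x*[y*z]≡y*[x*z] = solve-∀
    ev-supp : SupportedBy x (gcd d x * v)
    ev-supp w⊥x = coprime-*ʳ (coprime-∣ʳ w⊥x (gcd[m,n]∣n d x)) (v-supp w⊥x)

gcd-*ʳ : ∀ m n c → gcd m n * c ≡ gcd (m * c) (n * c)
gcd-*ʳ m n c = begin
  gcd m n * c          ≡⟨ *-comm (gcd m n) c ⟩
  c * gcd m n          ≡⟨ c*gcd[m,n]≡gcd[cm,cn] c m n ⟩
  gcd (c * m) (c * n)  ≡⟨ cong₂ gcd (*-comm c m) (*-comm c n) ⟩
  gcd (m * c) (n * c)  ∎
  where open ≡-Reasoning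

-- gcd a c · gcd b c = gcd(ab, ac, cb, cc), in the form of its universal property.
∣gcd*gcd : ∀ {P} a b c → P ∣ a * b → P ∣ a * c → P ∣ c * b → P ∣ c * c →
           P ∣ gcd a c * gcd b c
∣gcd*gcd {P} a b c P∣ab P∣ac P∣cb P∣cc =
  subst (P ∣_) (sym (gcd-*ʳ a c (gcd b c)))
    (gcd-greatest (subst (P ∣_) (sym (c*gcd[m,n]≡gcd[cm,cn] a b c)) (gcd-greatest P∣ab P∣ac))
                  (subst (P ∣_) (sym (c*gcd[m,n]≡gcd[cm,cn] c b c)) (gcd-greatest P∣cb P∣cc)))

gcd-of-gcds : ∀ a b c → gcd (gcd a c) (gcd b c) ≡ gcd (gcd a b) c
gcd-of-gcds a b c = ∣-antisym
  (gcd-greatest (gcd-greatest (∣-trans (gcd[m,n]∣m u v) (gcd[m,n]∣m a c))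
                              (∣-trans (gcd[m,n]∣n u v) (gcd[m,n]∣m b c)))
                (∣-trans (gcd[m,n]∣m u v) (gcd[m,n]∣n a c)))
  (gcd-greatest (gcd-greatest (∣-trans (gcd[m,n]∣m d c) (gcd[m,n]∣m a b)) (gcd[m,n]∣n d c))
                (gcd-greatest (∣-trans (gcd[m,n]∣m d c) (gcd[m,n]∣n a b)) (gcd[m,n]∣n d c)))
  where
  u = gcd a c
  v = gcd b c
  d = gcd a b

-- The inclusion gcd (lcm a b) c ∣ lcm (gcd a c) (gcd b c) is the hard one: with w = gcd(gcd a b, c),
-- the product gcd (lcm a b) c · w divides gcd a c · gcd b c = w · lcm (gcd a c) (gcd b c),
-- and w can be cancelled.
gcd-lcm-distrib : ∀ a b c → c ≥ 1 → gcd (lcm a b) c ≡ lcm (gcd a c) (gcd b c)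
gcd-lcm-distrib a b c c≥1 = ∣-antisym gcd∣lcm lcm∣gcd
  where
  l = lcm a b
  w = gcd (gcd a b) c
  P = gcd l c * w
  lcm∣gcd : lcm (gcd a c) (gcd b c) ∣ gcd l c
  lcm∣gcd = lcm-least
    (gcd-greatest (∣-trans (gcd[m,n]∣m a c) (m∣lcm[m,n] a b)) (gcd[m,n]∣n a c))
    (gcd-greatest (∣-trans (gcd[m,n]∣m b c) (n∣lcm[m,n] a b)) (gcd[m,n]∣n b c))
  P∣c*gcd[a,b] : P ∣ c * gcd a b
  P∣c*gcd[a,b] = *-pres-∣ (gcd[m,n]∣n l c) (gcd[m,n]∣m (gcd a b) c)
  P∣ab : P ∣ a * b
  P∣ab = subst (P ∣_) (trans (*-comm l (gcd a b)) (gcd*lcm a b))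
           (*-pres-∣ (gcd[m,n]∣m l c) (gcd[m,n]∣m (gcd a b) c))
  P∣ac : P ∣ a * c
  P∣ac = ∣-trans P∣c*gcd[a,b] (subst (c * gcd a b ∣_) (*-comm c a) (*-monoʳ-∣ c (gcd[m,n]∣m a b)))
  P∣cb : P ∣ c * b
  P∣cb = ∣-trans P∣c*gcd[a,b] (*-monoʳ-∣ c (gcd[m,n]∣n a b))
  P∣cc : P ∣ c * c
  P∣cc = *-pres-∣ (gcd[m,n]∣n l c) (gcd[m,n]∣n (gcd a b) c)
  gcd*gcd≡lcm*w : gcd a c * gcd b c ≡ lcm (gcd a c) (gcd b c) * w
  gcd*gcd≡lcm*w = trans (sym (gcd*lcm (gcd a c) (gcd b c)))
                        (trans (cong (_* lcm (gcd a c) (gcd b c)) (gcd-of-gcds a b c)) (*-comm w _))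
  gcd∣lcm : gcd l c ∣ lcm (gcd a c) (gcd b c)
  gcd∣lcm = *-cancelʳ-∣ w {{>-nonZero (gcd-pos (gcd a b) c≥1)}}
              (subst (P ∣_) gcd*gcd≡lcm*w (∣gcd*gcd a b c P∣ab P∣ac P∣cb P∣cc))

-- If d divides s, translating both u and u + d by s does not change their gcd:
-- both pairs have the same common divisors, namely the common divisors of u and d.
gcd-translate : ∀ u d s → d ∣ s → gcd (u + s) (u + d + s) ≡ gcd u (u + d)
gcd-translate u d s d∣s = ∣-antisym
  (gcd-greatest e∣u (∣m∣n⇒∣m+n e∣u e∣d))
  (gcd-greatest (∣m∣n⇒∣m+n e′∣u e′∣s) (∣m∣n⇒∣m+n (gcd[m,n]∣n u (u + d)) e′∣s))
  where
  e = gcd (u + s) (u + d + s)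
  e∣u+s = gcd[m,n]∣m (u + s) (u + d + s)
  u+d+s≡u+s+d : u + d + s ≡ u + s + d
  u+d+s≡u+s+d = trans (+-assoc u d s) (trans (cong (u +_) (+-comm d s)) (sym (+-assoc u s d)))
  e∣d : e ∣ d
  e∣d = ∣m+n∣m⇒∣n (subst (e ∣_) u+d+s≡u+s+d (gcd[m,n]∣n (u + s) (u + d + s))) e∣u+s
  e∣u : e ∣ u
  e∣u = ∣m+n∣m⇒∣n (subst (e ∣_) (+-comm u s) e∣u+s) (∣-trans e∣d d∣s)
  e′∣u = gcd[m,n]∣m u (u + d)
  e′∣s : gcd u (u + d) ∣ s
  e′∣s = ∣-trans (∣m+n∣m⇒∣n (gcd[m,n]∣n u (u + d)) e′∣u) d∣s

∣L : ∀ {m} K → m ≥ 1 → m ≤ K → m ∣ L K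
∣L zero    m≥1 m≤0 = contradiction (≤-trans m≥1 m≤0) λ ()
∣L (suc K) m≥1 m≤1+K with m≤n⇒m<n∨m≡n m≤1+K
... | inj₁ (s≤s m≤K) = ∣-trans (∣L K m≥1 m≤K) (m∣lcm[m,n] (L K) (suc K))
... | inj₂ refl      = n∣lcm[m,n] (L K) (suc K)

Positive : (ℕ → ℕ) → Set
Positive x = ∀ i → x i ≥ 1

lcmUpTo : (ℕ → ℕ) → ℕ → ℕ
lcmUpTo x zero    = x 0
lcmUpTo x (suc k) = lcm (lcmUpTo x k) (x (suc k))

lcmTerms≡lcmUpTo : ∀ k a b c n → lcmTerms k a b c n ≡ lcmUpTo (term a b c n) k
lcmTerms≡lcmUpTo zero    a b c n = refl
lcmTerms≡lcmUpTo (suc k) a b c n =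
  cong (λ l → lcm l (term a b c n (suc k))) (lcmTerms≡lcmUpTo k a b c n)

lcmUpTo-pos : ∀ {x} → Positive x → ∀ k → lcmUpTo x k ≥ 1
lcmUpTo-pos x>0 zero    = x>0 0
lcmUpTo-pos x>0 (suc k) = lcm-pos (lcmUpTo-pos x>0 k) (x>0 (suc k))

lcmUpTo-cong : ∀ {x y} k → (∀ i → i ≤ k → x i ≡ y i) → lcmUpTo x k ≡ lcmUpTo y k
lcmUpTo-cong zero    x≡y = x≡y 0 z≤n
lcmUpTo-cong (suc k) x≡y =
  cong₂ lcm (lcmUpTo-cong k λ i i≤k → x≡y i (m≤n⇒m≤1+n i≤k)) (x≡y (suc k) ≤-refl)

gcd-lcmUpTo : ∀ x k {y} → y ≥ 1 → gcd (lcmUpTo x k) y ≡ lcmUpTo (λ i → gcd (x i) y) k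
gcd-lcmUpTo x zero    y≥1 = refl
gcd-lcmUpTo x (suc k) {y} y≥1 =
  trans (gcd-lcm-distrib (lcmUpTo x k) (x (suc k)) y y≥1)
        (cong (λ l → lcm l (gcd (x (suc k)) y)) (gcd-lcmUpTo x k y≥1))

-- gcdWithNext x j = gcd (lcm_{i≤j} x i) (x (j+1)): the common part of the next term with
-- the running lcm; these are the factors g_{k,f} telescopes into.
gcdWithNext : (ℕ → ℕ) → ℕ → ℕ
gcdWithNext x j = gcd (lcmUpTo x j) (x (suc j))

SamePairwiseGcds : (ℕ → ℕ) → (ℕ → ℕ) → ℕ → Set
SamePairwiseGcds x y k = ∀ i j → i < j → j ≤ k → gcd (x i) (x j) ≡ gcd (y i) (y j)

-- By distributivity the gcdWithNext factors only depend on the pairwise gcds.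
gcdWithNext-invariant : ∀ {x y k} → Positive x → Positive y → SamePairwiseGcds x y k →
                        ∀ j → j < k → gcdWithNext x j ≡ gcdWithNext y j
gcdWithNext-invariant {x} {y} x>0 y>0 same j j<k = begin
  gcd (lcmUpTo x j) (x (suc j))               ≡⟨ gcd-lcmUpTo x j (x>0 (suc j)) ⟩
  lcmUpTo (λ i → gcd (x i) (x (suc j))) j     ≡⟨ lcmUpTo-cong j (λ i i≤j → same i (suc j) (s≤s i≤j) j<k) ⟩
  lcmUpTo (λ i → gcd (y i) (y (suc j))) j     ≡⟨ gcd-lcmUpTo y j (y>0 (suc j)) ⟨
  gcd (lcmUpTo y j) (y (suc j))               ∎
  where open ≡-Reasoning

term-pos : ∀ {a n} b c → a ≥ 1 → n ≥ 1 → Positive (term a b c n)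
term-pos {a} {n} b c a≥1 n≥1 i =
  ≤-trans (*-mono-≤ a≥1 (≤-trans n≥1 (m≤m+n n (i * c)))) (m≤n+m (a * (n + i * c)) b)

term-step : ∀ a b c n i t → term a b c n (i + t) ≡ term a b c n i + t * (a * c)
term-step a b c n i t = b+a[n+[i+t]c]≡b+a[n+ic]+t[ac] a b c n i t
  where
  b+a[n+[i+t]c]≡b+a[n+ic]+t[ac] : ∀ a b c n i t →
    b + a * (n + (i + t) * c) ≡ b + a * (n + i * c) + t * (a * c)
  b+a[n+[i+t]c]≡b+a[n+ic]+t[ac] = solve-∀

term-shift : ∀ a b c n l i → term a b c (n + c * l) i ≡ term a b c n i + l * (a * c)
term-shift a b c n l i = b+a[n+cl+ic]≡b+a[n+ic]+l[ac] a b c n l i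
  where
  b+a[n+cl+ic]≡b+a[n+ic]+l[ac] : ∀ a b c n l i →
    b + a * ((n + c * l) + i * c) ≡ b + a * (n + i * c) + l * (a * c)
  b+a[n+cl+ic]≡b+a[n+ic]+l[ac] = solve-∀

-- Shifting n by c L_k does not change gcd(x_i, x_j) for i < j ≤ k: all terms move by
-- L_k a c, a multiple of x_j - x_i = (j - i) a c since 1 ≤ j - i ≤ k.
progression-gcds : ∀ a b c n k → SamePairwiseGcds (term a b c (n + c * L k)) (term a b c n) k
progression-gcds a b c n k i j i<j j≤k = begin
  gcd (x′ i) (x′ j)                 ≡⟨ cong₂ gcd (term-shift a b c n (L k) i) (term-shift a b c n (L k) j) ⟩
  gcd (x i + s) (x j + s)           ≡⟨ cong (λ z → gcd (x i + s) (z + s)) xj≡xi+tac ⟩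
  gcd (x i + s) (x i + t * ac + s)  ≡⟨ gcd-translate (x i) (t * ac) s (*-monoˡ-∣ ac (∣L k t≥1 t≤k)) ⟩
  gcd (x i) (x i + t * ac)          ≡⟨ cong (gcd (x i)) xj≡xi+tac ⟨
  gcd (x i) (x j)                   ∎
  where
  open ≡-Reasoning
  x = term a b c n
  x′ = term a b c (n + c * L k)
  ac = a * c
  s = L k * ac
  t = j ∸ i
  t≥1 : t ≥ 1
  t≥1 = m<n⇒0<n∸m i<j
  t≤k : t ≤ k
  t≤k = ≤-trans (m∸n≤m j i) j≤k
  xj≡xi+tac : x j ≡ x i + t * ac
  xj≡xi+tac = trans (cong x (sym (m+[n∸m]≡n (<⇒≤ i<j)))) (term-step a b c n i t)

module _ {ℓ₁ ℓ₂ : Level} (G : AbelianGroup ℓ₁ ℓ₂) where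
  open AbelianGroup G
    using (Carrier; _≈_; _∙_; ε; _⁻¹; ∙-cong; ∙-congˡ; ∙-congʳ; assoc; inverseʳ;
           setoid; group; commutativeSemigroup)
    renaming (reflexive to ≈-reflexive)
  open SetoidReasoning setoid
  open CommSemigroupProperties commutativeSemigroup using (interchange)
  open import Algebra.Properties.Group group using (//-rightDividesˡ; //-rightDividesʳ)

  telescope-step : ∀ Q A B C D → A ∙ B ≈ C ∙ D → (Q ∙ B) ∙ D ⁻¹ ≈ (Q ∙ A ⁻¹) ∙ C
  telescope-step Q A B C D AB≈CD = begin
    (Q ∙ B) ∙ D ⁻¹                  ≈⟨ ∙-congʳ (∙-congʳ (//-rightDividesˡ A Q)) ⟨
    ((Q ∙ A ⁻¹) ∙ A ∙ B) ∙ D ⁻¹     ≈⟨ ∙-congʳ (assoc (Q ∙ A ⁻¹) A B) ⟩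
    ((Q ∙ A ⁻¹) ∙ (A ∙ B)) ∙ D ⁻¹   ≈⟨ ∙-congʳ (∙-congˡ AB≈CD) ⟩
    ((Q ∙ A ⁻¹) ∙ (C ∙ D)) ∙ D ⁻¹   ≈⟨ ∙-congʳ (assoc (Q ∙ A ⁻¹) C D) ⟨
    ((Q ∙ A ⁻¹) ∙ C ∙ D) ∙ D ⁻¹     ≈⟨ //-rightDividesʳ D ((Q ∙ A ⁻¹) ∙ C) ⟩
    (Q ∙ A ⁻¹) ∙ C                  ∎

  module _ (f : ℕ → Carrier) where

    prodUpTo : (ℕ → ℕ) → ℕ → Carrier
    prodUpTo x zero    = f (x 0)
    prodUpTo x (suc k) = prodUpTo x k ∙ f (x (suc k))

    prodTerms≡prodUpTo : ∀ k a b c n → prodTerms G f k a b c n ≡ prodUpTo (term a b c n) k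
    prodTerms≡prodUpTo zero    a b c n = refl
    prodTerms≡prodUpTo (suc k) a b c n =
      cong (_∙ f (term a b c n (suc k))) (prodTerms≡prodUpTo k a b c n)

    gcdProduct : (ℕ → ℕ) → ℕ → Carrier
    gcdProduct x zero    = ε
    gcdProduct x (suc j) = gcdProduct x j ∙ f (gcdWithNext x j)

    gcdProduct-invariant : ∀ {x y k} → Positive x → Positive y → SamePairwiseGcds x y k →
                           gcdProduct x k ≡ gcdProduct y k
    gcdProduct-invariant {x} {y} {k} x>0 y>0 same = upTo k ≤-refl
      where
      upTo : ∀ j → j ≤ k → gcdProduct x j ≡ gcdProduct y j
      upTo zero    _   = refl
      upTo (suc j) j<k =
        cong₂ _∙_ (upTo j (<⇒≤ j<k)) (cong f (gcdWithNext-invariant x>0 y>0 same j j<k))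

  module _ (f : ℕ → Carrier) (mult : Multiplicative G f) where

    f-cong : ∀ {m n} → m ≡ n → f m ≈ f n
    f-cong m≡n = ≈-reflexive (cong f m≡n)

    -- f (d x) f (d y) = f d f (d x y) for coprime x, y: split d = u v with u ⊥ x and v
    -- supported by x, so that d x = u · (v x), d y = v · (u y), d x y = (u v) · … are
    -- all products of coprime factors.
    f-scaled-coprime : ∀ d x y → d ≥ 1 → x ≥ 1 → y ≥ 1 → Coprime x y →
                       f (d * x) ∙ f (d * y) ≈ f d ∙ f (d * x * y)
    f-scaled-coprime d x y d≥1 x≥1 y≥1 x⊥y with coprimeSplit x d d≥1
    ... | u , v , refl , u⊥x , v-supp = begin
      f (u * v * x) ∙ f (u * v * y)         ≈⟨ ∙-cong (f-cong (*-assoc u v x)) (f-cong (uvy≡v[uy] u v y)) ⟩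
      f (u * (v * x)) ∙ f (v * (u * y))     ≈⟨ ∙-cong (mult u (v * x) u≥1 vx≥1 u⊥vx) (mult v (u * y) v≥1 uy≥1 v⊥uy) ⟩
      (f u ∙ f (v * x)) ∙ (f v ∙ f (u * y)) ≈⟨ interchange (f u) (f (v * x)) (f v) (f (u * y)) ⟩
      (f u ∙ f v) ∙ (f (v * x) ∙ f (u * y)) ≈⟨ ∙-cong (mult u v u≥1 v≥1 u⊥v) (mult (v * x) (u * y) vx≥1 uy≥1 vx⊥uy) ⟨
      f (u * v) ∙ f (v * x * (u * y))       ≈⟨ ∙-congˡ (f-cong (vx[uy]≡uvxy u v x y)) ⟩
      f (u * v) ∙ f (u * v * x * y)         ∎
      where
      uvy≡v[uy] : ∀ u v y → u * v * y ≡ v * (u * y)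
      uvy≡v[uy] = solve-∀
      vx[uy]≡uvxy : ∀ u v x y → v * x * (u * y) ≡ u * v * x * y
      vx[uy]≡uvxy = solve-∀
      u≥1 = ∣-pos (m∣m*n v) d≥1
      v≥1 = ∣-pos (n∣m*n u) d≥1
      vx≥1 = *-mono-≤ v≥1 x≥1
      uy≥1 = *-mono-≤ u≥1 y≥1
      u⊥v : Coprime u v
      u⊥v = v-supp u⊥x
      y⊥v : Coprime y v
      y⊥v = v-supp (coprime-sym x⊥y)
      u⊥vx : Coprime u (v * x)
      u⊥vx = coprime-*ʳ u⊥v u⊥x
      v⊥uy : Coprime v (u * y)
      v⊥uy = coprime-*ʳ (coprime-sym u⊥v) (coprime-sym y⊥v)
      vx⊥uy : Coprime (v * x) (u * y)
      vx⊥uy = coprime-*ʳ (coprime-sym u⊥vx) (coprime-sym (coprime-*ʳ y⊥v (coprime-sym x⊥y)))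

    -- The basic identity  f m f n = f (gcd m n) f (lcm m n)  for m, n ≥ 1:
    -- with d = gcd m n we have m = d x, n = d y, lcm m n = d x y and x ⊥ y.
    f-gcd-lcm : ∀ m n → m ≥ 1 → n ≥ 1 → f m ∙ f n ≈ f (gcd m n) ∙ f (lcm m n)
    f-gcd-lcm m n m≥1 n≥1 = begin
      f m ∙ f n             ≈⟨ ∙-cong (f-cong (sym dx≡m)) (f-cong (sym dy≡n)) ⟩
      f (d * x) ∙ f (d * y) ≈⟨ f-scaled-coprime d x y d≥1 x≥1 y≥1 (coprime-/gcd m n) ⟩
      f d ∙ f (d * x * y)   ≈⟨ ∙-congˡ (f-cong (sym lcm≡dxy)) ⟩
      f d ∙ f (lcm m n)     ∎
      where
      d = gcd m n
      d≥1 = gcd-pos m n≥1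
      instance
        d≢0 : NonZero d
        d≢0 = >-nonZero d≥1
      x = m / d
      y = n / d
      dx≡m : d * x ≡ m
      dx≡m = m*[n/m]≡n (gcd[m,n]∣m m n)
      dy≡n : d * y ≡ n
      dy≡n = m*[n/m]≡n (gcd[m,n]∣n m n)
      x≥1 = ∣-pos (n∣m*n d) (subst (_≥ 1) (sym dx≡m) m≥1)
      y≥1 = ∣-pos (n∣m*n d) (subst (_≥ 1) (sym dy≡n) n≥1)
      d[dxy]≡dx[dy] : ∀ d x y → d * (d * x * y) ≡ d * x * (d * y)
      d[dxy]≡dx[dy] = solve-∀
      lcm≡dxy : lcm m n ≡ d * x * y
      lcm≡dxy = *-cancelˡ-≡ (lcm m n) (d * x * y) d
        (trans (gcd*lcm m n) (trans (cong₂ _*_ (sym dx≡m) (sym dy≡n)) (sym (d[dxy]≡dx[dy] d x y))))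

    -- Telescoping: ∏_{i≤k} f (x i) / f (lcm_{i≤k} x i) = ∏_{j<k} f (gcdWithNext x j), by
    -- f (lcm_{i≤j} x i) f (x (j+1)) = f (gcdWithNext x j) f (lcm_{i≤j+1} x i).
    telescope : ∀ {x} → Positive x → ∀ k → prodUpTo f x k ∙ f (lcmUpTo x k) ⁻¹ ≈ gcdProduct f x k
    telescope {x} x>0 zero    = inverseʳ (f (x 0))
    telescope {x} x>0 (suc j) = begin
      (prodUpTo f x j ∙ f (x (suc j))) ∙ f (lcmUpTo x (suc j)) ⁻¹
        ≈⟨ telescope-step (prodUpTo f x j) (f (lcmUpTo x j)) (f (x (suc j)))
                          (f (gcdWithNext x j)) (f (lcmUpTo x (suc j)))
                          (f-gcd-lcm (lcmUpTo x j) (x (suc j)) (lcmUpTo-pos x>0 j) (x>0 (suc j))) ⟩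
      (prodUpTo f x j ∙ f (lcmUpTo x j) ⁻¹) ∙ f (gcdWithNext x j)
        ≈⟨ ∙-congʳ (telescope x>0 j) ⟩
      gcdProduct f x j ∙ f (gcdWithNext x j) ∎

    g≈gcdProduct : ∀ k {a} b c {n} → a ≥ 1 → n ≥ 1 → g G f k a b c n ≈ gcdProduct f (term a b c n) k
    g≈gcdProduct k {a} b c {n} a≥1 n≥1 = begin
      g G f k a b c n
        ≡⟨ cong₂ (λ p l → p ∙ f l ⁻¹) (prodTerms≡prodUpTo f k a b c n) (lcmTerms≡lcmUpTo k a b c n) ⟩
      prodUpTo f (term a b c n) k ∙ f (lcmUpTo (term a b c n) k) ⁻¹
        ≈⟨ telescope (term-pos b c a≥1 n≥1) k ⟩
      gcdProduct f (term a b c n) k ∎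

-- The theorem: g_{k,f} is a product of f over gcds that the shift n ↦ n + c L_k preserves.

theorem1p2 : {ℓ₁ ℓ₂ : Level} (G : AbelianGroup ℓ₁ ℓ₂) (f : ℕ → AbelianGroup.Carrier G) →
    Multiplicative G f →
    (k a b c : ℕ) → k ≥ 1 → a ≥ 1 → c ≥ 1 →
    (n : ℕ) → n ≥ 1 →
    AbelianGroup._≈_ G (g G f k a b c (n + c * L k)) (g G f k a b c n)
theorem1p2 G f mult k a b c _ a≥1 _ n n≥1 = begin
  g G f k a b c (n + c * L k)               ≈⟨ g≈gcdProduct G f mult k b c a≥1 n′≥1 ⟩
  gcdProduct G f (term a b c (n + c * L k)) k
    ≡⟨ gcdProduct-invariant G f (term-pos b c a≥1 n′≥1) (term-pos b c a≥1 n≥1) (progression-gcds a b c n k) ⟩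
  gcdProduct G f (term a b c n) k           ≈⟨ g≈gcdProduct G f mult k b c a≥1 n≥1 ⟨
  g G f k a b c n                           ∎
  where
  open SetoidReasoning (AbelianGroup.setoid G)
  n′≥1 : n + c * L k ≥ 1
  n′≥1 = ≤-trans n≥1 (m≤m+n n (c * L k))
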